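{- Let $H_1, H_2\in\mathcal{H}$ with $H_1\le H_2$. Then (1) $|E(H_1)|\le |E(H_2)|+1$; (2) $|V(H_1)|\le |V(H_2)|+2$; (3) $\Delta(H_1)\le \Delta(H_2)+1$; moreover, if $\Delta(H_1)=\Delta(H_2)+1$, then $H_1$ contains at most two vertices of degree $\Delta(H_1)$, and if $H_1$ contains two vertices of degree $\Delta(H_2)+1$, they are adjacent; (4) if $H_2$ is not a tree, then $\dim(H_1)\le \dim(H_2)$.
   Context: All graphs are finite and simple, and are considered up to isomorphism. An edge-colored graph is a pair $(G,c)$ with $c\colon E(G)\to\mathbb{N}$ an arbitrary map (not necessarily a proper coloring); it is colored in $t$ or more colors if $|c(E(G))|\ge t$. A subgraph (not necessarily induced) is rainbow if its edges receive pairwise distinct colors. $(G,c)$ is rainbow $H$-free if $G$ contains no rainbow subgraph isomorphic to $H$. For graphs $H_1,H_2$, write $H_1\le H_2$ if there is a positive integer $t$ such that every rainbow $H_1$-free edge-colored complete graph colored in $t$ or more colors is rainbow $H_2$-free. $\mathcal{H}$ denotes the set of connected finite simple graphs other than the paths $P_1,P_2,P_3,P_4$ ($P_k$ is the path on $k$ vertices). $\Delta(G)$ is the maximum degree. For a connected graph $G$, $\dim G=|E(G)|-|V(G)|+1$. -}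

module Defs where

open import Data.Nat using (ℕ; zero; suc; _+_; _≤_; _<_; _⊔_)
open import Data.Nat.Properties using (_≟_)
open import Data.Integer as ℤ using (ℤ; +_)
open import Data.Fin using (Fin; zero; suc; toℕ; inject₁; fromℕ)
open import Data.Bool using (Bool; true; false; if_then_else_)
open import Data.Product using (Σ; _×_; _,_; ∃; proj₁; proj₂)
open import Relation.Nullary.Decidable using (dec-false)
open import Data.Bool.Properties using (∨-comm)
open import Data.Nat.Properties using (1+n≢n)
open import Data.Sum using (_⊎_)
open import Relation.Binary.PropositionalEquality using (_≡_; _≢_; refl) renaming (sym to sym≡)
open import Relation.Nullary using (¬_; does; yes; no)
open import Function.Definitions using (Injective)
open import Function.Bundles using (_↔_; Inverse)

record Graph : Set where
  field
    n     : ℕ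
    adj   : Fin n → Fin n → Bool
    sym   : ∀ u v → adj u v ≡ adj v u
    irrefl : ∀ v → adj v v ≡ false
open Graph public

sumFin : ∀ {k} → (Fin k → ℕ) → ℕ
sumFin {zero}  f = 0
sumFin {suc k} f = f zero + sumFin (λ i → f (suc i))

maxFin : ∀ {k} → (Fin k → ℕ) → ℕ
maxFin {zero}  f = 0
maxFin {suc k} f = f zero ⊔ maxFin (λ i → f (suc i))

b2n : Bool → ℕ
b2n true  = 1
b2n false = 0

_<ᵇ_ : ℕ → ℕ → Bool
a <ᵇ b = Data.Nat._<ᵇ_ a b

∣V∣ : Graph → ℕ
∣V∣ G = n G

∣E∣ : Graph → ℕ
∣E∣ G = sumFin (λ i → sumFin (λ j →
          if adj G i j then b2n (toℕ i <ᵇ toℕ j) else 0))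

deg : (G : Graph) → Fin (n G) → ℕ
deg G v = sumFin (λ u → b2n (adj G v u))

Δ : Graph → ℕ
Δ G = maxFin (deg G)

countDeg : (G : Graph) → ℕ → ℕ
countDeg G d = sumFin (λ v → b2n (does (deg G v ≟ d)))

dim : Graph → ℤ
dim G = (+ ∣E∣ G) ℤ.- (+ ∣V∣ G) ℤ.+ (+ 1)

data Reach (G : Graph) : Fin (n G) → Fin (n G) → Set where
  here : ∀ {v} → Reach G v v
  step : ∀ {u w v} → adj G u w ≡ true → Reach G w v → Reach G u v

Connected : Graph → Set
Connected G = ∀ u v → Reach G u v

-- a cycle of length j+3: distinct vertices f 0, …, f (j+2), consecutive adjacent,
-- and the last adjacent to the first
HasCycle : Graph → Set
HasCycle G = Σ ℕ λ j → Σ (Fin (suc (suc (suc j))) → Fin (n G)) λ f →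
  Injective _≡_ _≡_ f ×
  (∀ (i : Fin (suc (suc j))) → adj G (f (inject₁ i)) (f (suc i)) ≡ true) ×
  (adj G (f (fromℕ (suc (suc j)))) (f zero) ≡ true)

IsTree : Graph → Set
IsTree G = Connected G × ¬ HasCycle G

_≅_ : Graph → Graph → Set
G ≅ H = Σ (Fin (n G) ↔ Fin (n H)) λ φ →
  ∀ u v → adj H (Inverse.to φ u) (Inverse.to φ v) ≡ adj G u v

pathAdj : ∀ {k} → Fin k → Fin k → Bool
pathAdj i j = does (suc (toℕ i) ≟ toℕ j) Data.Bool.∨ does (suc (toℕ j) ≟ toℕ i)

pathSym : ∀ {k} (i j : Fin k) → pathAdj i j ≡ pathAdj j i
pathSym i j = ∨-comm (does (suc (toℕ i) ≟ toℕ j)) (does (suc (toℕ j) ≟ toℕ i))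

private
  noSelf : ∀ m → does (suc m ≟ m) ≡ false
  noSelf m = dec-false (suc m ≟ m) 1+n≢n

pathIrrefl : ∀ {k} (i : Fin k) → pathAdj i i ≡ false
pathIrrefl i rewrite noSelf (toℕ i) = refl

P : ℕ → Graph
P k = record { n = k ; adj = pathAdj ; sym = pathSym ; irrefl = pathIrrefl }

record In𝓗 (G : Graph) : Set where
  field
    nonempty  : 1 ≤ n G
    connected : Connected G
    notPath   : ∀ k → 1 ≤ k → k ≤ 4 → ¬ (G ≅ P k)

record Coloring (m : ℕ) : Set where
  field
    col    : Fin m → Fin m → ℕ
    colSym : ∀ i j → col i j ≡ col j i
open Coloring public

-- c uses t or more colours: there are t edges of K_m with pairwise distinct colours
UsesAtLeast : ∀ {m} → Coloring m → ℕ → Set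
UsesAtLeast {m} c t = Σ (Fin t → Fin m × Fin m) λ e →
  (∀ k → proj₁ (e k) ≢ proj₂ (e k)) ×
  (∀ k l → col c (proj₁ (e k)) (proj₂ (e k)) ≡ col c (proj₁ (e l)) (proj₂ (e l)) → k ≡ l)

RainbowCopy : (H : Graph) → ∀ {m} → Coloring m → Set
RainbowCopy H {m} c = Σ (Fin (n H) → Fin m) λ f →
  Injective _≡_ _≡_ f ×
  (∀ u v u' v' → adj H u v ≡ true → adj H u' v' ≡ true →
     col c (f u) (f v) ≡ col c (f u') (f v') →
     (u ≡ u' × v ≡ v') ⊎ (u ≡ v' × v ≡ u'))

RainbowFree : (H : Graph) → ∀ {m} → Coloring m → Set
RainbowFree H c = ¬ RainbowCopy H c

_≼_ : Graph → Graph → Set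
H₁ ≼ H₂ = Σ ℕ λ t → 1 ≤ t × (∀ m (c : Coloring m) → UsesAtLeast c t →
             RainbowFree H₁ c → RainbowFree H₂ c)

{-# OPTIONS --safe #-}
module Submission where

-- Colour the complete graph on V(H₂) and the ends of t new disjoint edges: H₂ rainbow, the
-- new edges in t distinct colours, and every other edge in the colour of a fixed edge pq of
-- H₂. This colouring uses t colours and contains a rainbow H₂, so H₁ ≤ H₂ gives a rainbow H₁
-- (up to double negation, which is harmless since every conclusion is decidable). At most
-- one edge of that copy of H₁ has the colour of pq, and every other edge lies in H₂ - pq or
-- is a new edge. As H₁ is connected, it meets at most two new edges, and at most one if it
-- meets H₂. Counting arcs (ordered adjacent pairs, twice the edges), vertices and degrees
-- gives (1)-(3); in particular a degree exceeds Δ(H₂) only at an end of the edge coloured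
-- like pq. For (4) take pq on a cycle, so that H₂ - pq is connected: every vertex of H₂
-- missed by H₁ then pays for an edge of H₂ not used by H₁.

open import Defs hiding (sym)

open import Data.Bool using (Bool; true; false; _∧_; _∨_; not; if_then_else_; _xor_)
import Data.Bool.Properties as Bool
open import Data.Empty using (⊥; ⊥-elim)
open import Data.Fin using (Fin; zero; suc; toℕ; inject₁; fromℕ; combine)
open import Data.Fin.Properties as Fin using (_≟_; any?)
open import Data.Integer as ℤ using (_⊖_) renaming (_≤_ to _≤ℤ_)
import Data.Integer.Properties as ℤ
open import Data.Nat using (ℕ; zero; suc; _+_; _*_; _≤_; _<_; _⊔_; z≤n; s≤s; z<s)
open import Data.Nat.Properties as ℕ using (≤-refl; ≤-trans; ≤-reflexive; +-mono-≤; +-monoʳ-≤; +-monoˡ-≤)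
open import Data.Nat.Solver using (module +-*-Solver)
open +-*-Solver using (solve; _:+_; _:*_; con; _:=_)
open import Algebra.Properties.CommutativeMonoid.Sum ℕ.+-0-commutativeMonoid
  using (sum; ∑-distrib-+; ∑-comm; sum-cong-≗)
open import Algebra.Properties.CommutativeSemigroup ℕ.+-commutativeSemigroup using (x∙yz≈y∙xz)
open import Data.Product using (∃; ∃₂; _×_; _,_; proj₁; proj₂)
open import Data.Product.Function.NonDependent.Propositional using (_×-↔_)
import Data.Product.Properties as Prod
open import Data.Sum using (_⊎_; inj₁; inj₂; fromInj₁) renaming (map to ⊎-map)
open import Data.Sum.Function.Propositional using (_⊎-↔_)
import Data.Sum.Properties as Sum
open import Function using (_∘_; case_of_)
open import Function.Bundles using (_↔_; Inverse; Injection)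
open import Function.Properties.Inverse using (↔-refl; ↔-sym; ↔-trans; ↔⇒↣)
open import Relation.Binary.PropositionalEquality hiding ([_])
open import Relation.Nullary using (¬_; Dec; yes; no; does)
open import Relation.Nullary.Decidable using (dec-true; dec-false; decidable-stable)
open import Relation.Nullary.Negation using (¬¬-map)

private
  variable
    a b k : ℕ

-- Sums and counts over Fin

sumFin≡sum : (f : Fin k → ℕ) → sumFin f ≡ sum f
sumFin≡sum {zero}  f = refl
sumFin≡sum {suc k} f = cong (f zero +_) (sumFin≡sum (f ∘ suc))

sumFin-cong : {f g : Fin k → ℕ} → (∀ i → f i ≡ g i) → sumFin f ≡ sumFin g
sumFin-cong {f = f} {g} f≗g = begin
  sumFin f ≡⟨ sumFin≡sum f ⟩
  sum f    ≡⟨ sum-cong-≗ f≗g ⟩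
  sum g    ≡⟨ sumFin≡sum g ⟨
  sumFin g ∎
  where open ≡-Reasoning

sumFin-distrib-+ : (f g : Fin k → ℕ) → sumFin (λ i → f i + g i) ≡ sumFin f + sumFin g
sumFin-distrib-+ f g = begin
  sumFin (λ i → f i + g i) ≡⟨ sumFin≡sum (λ i → f i + g i) ⟩
  sum (λ i → f i + g i)    ≡⟨ ∑-distrib-+ f g ⟩
  sum f + sum g            ≡⟨ cong₂ _+_ (sumFin≡sum f) (sumFin≡sum g) ⟨
  sumFin f + sumFin g      ∎
  where open ≡-Reasoning

sumFin-comm : (f : Fin a → Fin b → ℕ) →
  sumFin (λ i → sumFin (f i)) ≡ sumFin (λ j → sumFin (λ i → f i j))
sumFin-comm f = begin
  sumFin (λ i → sumFin (f i))         ≡⟨ sumFin-cong (λ i → sumFin≡sum (f i)) ⟩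
  sumFin (λ i → sum (f i))            ≡⟨ sumFin≡sum (λ i → sum (f i)) ⟩
  sum (λ i → sum (f i))               ≡⟨ ∑-comm f ⟩
  sum (λ j → sum (λ i → f i j))       ≡⟨ sumFin≡sum (λ j → sum (λ i → f i j)) ⟨
  sumFin (λ j → sum (λ i → f i j))    ≡⟨ sumFin-cong (λ j → sumFin≡sum (λ i → f i j)) ⟨
  sumFin (λ j → sumFin (λ i → f i j)) ∎
  where open ≡-Reasoning

sumFin-mono : {f g : Fin k → ℕ} → (∀ i → f i ≤ g i) → sumFin f ≤ sumFin g
sumFin-mono {zero}  f≤g = z≤n
sumFin-mono {suc k} f≤g = +-mono-≤ (f≤g zero) (sumFin-mono (f≤g ∘ suc))

sumFin-const : ∀ k c → sumFin {k} (λ _ → c) ≡ k * c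
sumFin-const zero    c = refl
sumFin-const (suc k) c = cong (c +_) (sumFin-const k c)

sumFin-zero : {f : Fin k → ℕ} → (∀ i → f i ≡ 0) → sumFin f ≡ 0
sumFin-zero {k} f≡0 = trans (sumFin-cong f≡0) (trans (sumFin-const k 0) (ℕ.*-zeroʳ k))

sumFin-pick : (f : Fin k → ℕ) (y : Fin k) →
  sumFin f ≡ f y + sumFin (λ j → if does (j ≟ y) then 0 else f j)
sumFin-pick f zero    = refl
sumFin-pick f (suc y) = begin
  f zero + sumFin (f ∘ suc)                                                   ≡⟨ cong (f zero +_) (sumFin-pick (f ∘ suc) y) ⟩
  f zero + (f (suc y) + sumFin (λ j → if does (j ≟ y) then 0 else f (suc j))) ≡⟨ x∙yz≈y∙xz (f zero) (f (suc y)) _ ⟩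
  f (suc y) + (f zero + sumFin (λ j → if does (j ≟ y) then 0 else f (suc j))) ∎
  where open ≡-Reasoning

-- Charge w zero to f (g zero) and clear that entry of f; injectivity keeps the rest of w off it.
sumFin-injection : (g : Fin a → Fin b) (w : Fin a → ℕ) (f : Fin b → ℕ) →
  (∀ i → w i ≤ f (g i)) → (∀ {i j} → 0 < w i → 0 < w j → g i ≡ g j → i ≡ j) →
  sumFin w ≤ sumFin f
sumFin-injection {zero}  g w f w≤fg injective = z≤n
sumFin-injection {suc a} g w f w≤fg injective with w zero in w₀
... | zero  = sumFin-injection (g ∘ suc) (w ∘ suc) f (w≤fg ∘ suc)
                (λ pᵢ pⱼ same → Fin.suc-injective (injective pᵢ pⱼ same))
... | suc c = begin
  suc c + sumFin (w ∘ suc) ≤⟨ +-mono-≤ (subst (_≤ f (g zero)) w₀ (w≤fg zero))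
                                       (sumFin-injection (g ∘ suc) (w ∘ suc) f′ bound
                                          (λ pᵢ pⱼ same → Fin.suc-injective (injective pᵢ pⱼ same))) ⟩
  f (g zero) + sumFin f′   ≡⟨ sumFin-pick f (g zero) ⟨
  sumFin f                 ∎
  where
  open ℕ.≤-Reasoning
  f′ : Fin _ → ℕ
  f′ j = if does (j ≟ g zero) then 0 else f j
  bound : ∀ i → w (suc i) ≤ f′ (g (suc i))
  bound i with g (suc i) ≟ g zero | w (suc i) in wᵢ
  ... | no _     | _     = subst (_≤ f (g (suc i))) wᵢ (w≤fg (suc i))
  ... | yes _    | zero  = z≤n
  ... | yes same | suc _ with () ← injective (subst (0 <_) (sym wᵢ) z<s) (subst (0 <_) (sym w₀) z<s) same

sumFin-witness : (f : Fin k → ℕ) → 0 < sumFin f → ∃ λ i → 0 < f i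
sumFin-witness {suc k} f 0<Σ with f zero in f₀
... | suc _ = zero , subst (0 <_) (sym f₀) z<s
... | zero  = let (i , 0<fᵢ) = sumFin-witness (f ∘ suc) 0<Σ in suc i , 0<fᵢ

sumFin-≤-by-witness : {f : Fin k → ℕ} {c : ℕ} → (∀ {i} → 0 < f i → sumFin f ≤ c) → sumFin f ≤ c
sumFin-≤-by-witness {f = f} bound with sumFin f in Σf
... | zero  = z≤n
... | suc _ = bound (proj₂ (sumFin-witness f (subst (0 <_) (sym Σf) z<s)))

does-sound : {A : Set} (d : Dec A) → does d ≡ true → A
does-sound (yes a) _ = a

not≡true⇒≡false : ∀ {x} → not x ≡ true → x ≡ false
not≡true⇒≡false {false} _ = refl

∧-true : ∀ {x y} → x ∧ y ≡ true → x ≡ true × y ≡ true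
∧-true {true} y≡true = refl , y≡true

not-∧-antitone : ∀ {x y x′ y′} → (x ≡ true → x′ ≡ true) → (y ≡ true → y′ ≡ true) →
  not (x′ ∧ y′) ≡ true → not (x ∧ y) ≡ true
not-∧-antitone {true}  {true}  x⇒x′ y⇒y′ out rewrite x⇒x′ refl | y⇒y′ refl = out
not-∧-antitone {true}  {false} _    _    _   = refl
not-∧-antitone {false}         _    _    _   = refl

b2n-mono : ∀ {x y} → (x ≡ true → y ≡ true) → b2n x ≤ b2n y
b2n-mono {false} x⇒y = z≤n
b2n-mono {true}  x⇒y rewrite x⇒y refl = ≤-refl

b2n-positive : ∀ {x} → 0 < b2n x → x ≡ true
b2n-positive {true} _ = refl

b2n-split : ∀ x y → b2n x ≡ b2n (x ∧ y) + b2n (x ∧ not y)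
b2n-split false y     = refl
b2n-split true  false = refl
b2n-split true  true  = refl

1≤b2n+b2n : ∀ {x y} → x ≡ true ⊎ y ≡ true → 1 ≤ b2n x + b2n y
1≤b2n+b2n     (inj₁ refl) = s≤s z≤n
1≤b2n+b2n {x} (inj₂ refl) = ℕ.m≤n+m 1 (b2n x)

count : (Fin k → Bool) → ℕ
count P = sumFin (λ i → b2n (P i))

[_≟_] : Fin k → Fin k → ℕ
[ i ≟ j ] = b2n (does (i ≟ j))

[≟]-refl : (i : Fin k) → [ i ≟ i ] ≡ 1
[≟]-refl i = cong b2n (dec-true (i ≟ i) refl)

[≟]-≢ : {i j : Fin k} → i ≢ j → [ i ≟ j ] ≡ 0
[≟]-≢ {i = i} {j} i≢j = cong b2n (dec-false (i ≟ j) i≢j)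

count-injection : {P : Fin a → Bool} {Q : Fin b → Bool} (g : Fin a → Fin b) →
  (∀ {i} → P i ≡ true → Q (g i) ≡ true) →
  (∀ {i j} → P i ≡ true → P j ≡ true → g i ≡ g j → i ≡ j) →
  count P ≤ count Q
count-injection g P⇒Qg injective = sumFin-injection g _ _ (λ i → b2n-mono (P⇒Qg {i}))
  (λ {i} {j} pᵢ pⱼ → injective {i} {j} (b2n-positive pᵢ) (b2n-positive pⱼ))

count-mono : {P Q : Fin k → Bool} → (∀ {i} → P i ≡ true → Q i ≡ true) → count P ≤ count Q
count-mono P⇒Q = sumFin-mono (λ i → b2n-mono (P⇒Q {i}))

count-positive : {P : Fin k → Bool} {j : Fin k} → P j ≡ true → 1 ≤ count P
count-positive {j = j} Pⱼ = count-injection {P = λ (_ : Fin 1) → true} (λ _ → j) (λ _ → Pⱼ)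
  (λ { {zero} {zero} _ _ _ → refl })

count-≤1 : {P : Fin k → Bool} → (∀ {i j} → P i ≡ true → P j ≡ true → i ≡ j) → count P ≤ 1
count-≤1 unique = count-injection {Q = λ (_ : Fin 1) → true} (λ _ → zero) (λ _ → refl)
  (λ {i} {j} pᵢ pⱼ _ → unique {i} {j} pᵢ pⱼ)

count-all : ∀ k → count {k} (λ _ → true) ≡ k
count-all k = trans (sumFin-const k 1) (ℕ.*-identityʳ k)

count-none : {P : Fin k → Bool} → (∀ i → P i ≡ false) → count P ≡ 0
count-none P≡false = sumFin-zero (λ i → cong b2n (P≡false i))

count-complement : (P : Fin k → Bool) → count P + count (not ∘ P) ≡ k
count-complement {k} P = begin
  count P + count (not ∘ P)                  ≡⟨ sumFin-distrib-+ (λ i → b2n (P i)) _ ⟨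
  sumFin (λ i → b2n (P i) + b2n (not (P i))) ≡⟨ sumFin-cong (λ i → sym (b2n-split true (P i))) ⟩
  count {k} (λ _ → true)                     ≡⟨ count-all k ⟩
  k                                          ∎
  where open ≡-Reasoning

count-witness : {P : Fin k → Bool} → 0 < count P → ∃ λ i → P i ≡ true
count-witness {P = P} 0<count = let (i , 0<Pᵢ) = sumFin-witness (λ i → b2n (P i)) 0<count in
  i , b2n-positive 0<Pᵢ

count-≤-by-witness : {P : Fin k → Bool} {c : ℕ} → (∀ {i} → P i ≡ true → count P ≤ c) → count P ≤ c
count-≤-by-witness {P = P} bound =
  sumFin-≤-by-witness {f = λ i → b2n (P i)} (λ {i} 0<Pᵢ → bound {i} (b2n-positive 0<Pᵢ))

sumFin-indicator : (j : Fin k) → sumFin (λ i → [ i ≟ j ]) ≡ 1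
sumFin-indicator {suc k} zero    = cong suc (count-none {k} {λ i → does (suc i ≟ zero)} (λ _ → refl))
sumFin-indicator {suc k} (suc j) = sumFin-indicator j

sumFin-indicators : (x y : Fin k) → sumFin (λ i → [ i ≟ x ] + [ i ≟ y ]) ≡ 2
sumFin-indicators x y = trans (sumFin-distrib-+ (λ i → [ i ≟ x ]) _)
                              (cong₂ _+_ (sumFin-indicator x) (sumFin-indicator y))

count-< : {P Q : Fin k → Bool} {j : Fin k} → (∀ {i} → P i ≡ true → Q i ≡ true) →
  Q j ≡ true → P j ≡ false → count P < count Q
count-< {P = P} {Q} {j} P⇒Q Qⱼ Pⱼ = begin
  suc (count P)                       ≡⟨ ℕ.+-comm 1 (count P) ⟩
  count P + 1                         ≡⟨ cong (count P +_) (sumFin-indicator j) ⟨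
  count P + sumFin (λ i → [ i ≟ j ])  ≡⟨ sumFin-distrib-+ (λ i → b2n (P i)) (λ i → [ i ≟ j ]) ⟨
  sumFin (λ i → b2n (P i) + [ i ≟ j ]) ≤⟨ sumFin-mono pointwise ⟩
  count Q                             ∎
  where
  open ℕ.≤-Reasoning
  pointwise : ∀ i → b2n (P i) + [ i ≟ j ] ≤ b2n (Q i)
  pointwise i with i ≟ j
  ... | yes refl rewrite Pⱼ | Qⱼ = ≤-refl
  ... | no  _    = ≤-trans (≤-reflexive (ℕ.+-identityʳ _)) (b2n-mono (P⇒Q {i}))

-- Arcs and degrees

arcs : (Fin k → Fin k → Bool) → ℕ
arcs R = sumFin (λ u → count (R u))

inside leaving : (Fin k → Bool) → (Fin k → Fin k → Bool) → Fin k → Fin k → Bool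
inside  X R a b = R a b ∧ (X a ∧ X b)
leaving X R a b = R a b ∧ not (X a ∧ X b)

arcs-mono : {R R′ : Fin k → Fin k → Bool} → (∀ {a b} → R′ a b ≡ true → R a b ≡ true) → arcs R′ ≤ arcs R
arcs-mono {R = R} {R′} R′⊆R = sumFin-mono (λ a → count-mono {P = R′ a} {R a} R′⊆R)

arcs-inside+leaving : (X : Fin k → Bool) (R : Fin k → Fin k → Bool) →
  arcs (inside X R) + arcs (leaving X R) ≡ arcs R
arcs-inside+leaving X R = begin
  arcs (inside X R) + arcs (leaving X R)
    ≡⟨ sumFin-distrib-+ (λ a → count (inside X R a)) _ ⟨
  sumFin (λ a → count (inside X R a) + count (leaving X R a))
    ≡⟨ sumFin-cong (λ a → sumFin-distrib-+ (λ b → b2n (inside X R a b)) _) ⟨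
  sumFin (λ a → sumFin (λ b → b2n (inside X R a b) + b2n (leaving X R a b)))
    ≡⟨ sumFin-cong (λ a → sumFin-cong (λ b → sym (b2n-split (R a b) (X a ∧ X b)))) ⟩
  arcs R
    ∎
  where open ≡-Reasoning

arcs-missing-edge : {R R′ : Fin k → Fin k → Bool} {x y : Fin k} → x ≢ y →
  (∀ {a b} → R′ a b ≡ true → R a b ≡ true) →
  R x y ≡ true → R′ x y ≡ false → R y x ≡ true → R′ y x ≡ false →
  2 + arcs R′ ≤ arcs R
arcs-missing-edge {R = R} {R′} {x} {y} x≢y R′⊆R Rxy R′xy Ryx R′yx = begin
  2 + arcs R′                                            ≡⟨ cong (_+ arcs R′) (sumFin-indicators x y) ⟨
  sumFin (λ a → [ a ≟ x ] + [ a ≟ y ]) + arcs R′          ≡⟨ sumFin-distrib-+ _ (λ a → count (R′ a)) ⟨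
  sumFin (λ a → [ a ≟ x ] + [ a ≟ y ] + count (R′ a))     ≤⟨ sumFin-mono (λ a → at a (a ≟ x) (a ≟ y)) ⟩
  arcs R                                                 ∎
  where
  open ℕ.≤-Reasoning
  at : ∀ a → Dec (a ≡ x) → Dec (a ≡ y) → [ a ≟ x ] + [ a ≟ y ] + count (R′ a) ≤ count (R a)
  at a (yes refl) (yes refl) = ⊥-elim (x≢y refl)
  at a (yes refl) (no x≢y′)  = begin
    [ x ≟ x ] + [ x ≟ y ] + count (R′ x) ≡⟨ cong₂ (λ c d → c + d + count (R′ x)) ([≟]-refl x) ([≟]-≢ x≢y′) ⟩
    suc (count (R′ x))                   ≤⟨ count-< {P = R′ x} {R x} R′⊆R Rxy R′xy ⟩
    count (R x)                          ∎
  at a (no y≢x)   (yes refl) = begin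
    [ y ≟ x ] + [ y ≟ y ] + count (R′ y) ≡⟨ cong₂ (λ c d → c + d + count (R′ y)) ([≟]-≢ y≢x) ([≟]-refl y) ⟩
    suc (count (R′ y))                   ≤⟨ count-< {P = R′ y} {R y} R′⊆R Ryx R′yx ⟩
    count (R y)                          ∎
  at a (no a≢x)   (no a≢y)   = begin
    [ a ≟ x ] + [ a ≟ y ] + count (R′ a) ≡⟨ cong₂ (λ c d → c + d + count (R′ a)) ([≟]-≢ a≢x) ([≟]-≢ a≢y) ⟩
    count (R′ a)                         ≤⟨ count-mono {P = R′ a} {R a} R′⊆R ⟩
    count (R a)                          ∎

<ᵇ-connex : ∀ x y → x ≢ y → b2n (x <ᵇ y) + b2n (y <ᵇ x) ≡ 1
<ᵇ-connex zero    zero    x≢y = ⊥-elim (x≢y refl)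
<ᵇ-connex zero    (suc y) x≢y = refl
<ᵇ-connex (suc x) zero    x≢y = refl
<ᵇ-connex (suc x) (suc y) x≢y = <ᵇ-connex x y (x≢y ∘ cong suc)

adj⇒≢ : (G : Graph) {a b : Fin (n G)} → adj G a b ≡ true → a ≢ b
adj⇒≢ G {a} aa refl = case trans (sym aa) (irrefl G a) of λ ()

handshake : (G : Graph) → arcs (adj G) ≡ 2 * ∣E∣ G
handshake G = begin
  arcs (adj G)                                       ≡⟨ sumFin-cong (λ i → sumFin-cong (arc-split i)) ⟩
  sumFin (λ i → sumFin (λ j → e i j + e j i))        ≡⟨ sumFin-cong (λ i → sumFin-distrib-+ (e i) (λ j → e j i)) ⟩
  sumFin (λ i → sumFin (e i) + sumFin (λ j → e j i)) ≡⟨ sumFin-distrib-+ (λ i → sumFin (e i)) _ ⟩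
  ∣E∣ G + sumFin (λ i → sumFin (λ j → e j i))        ≡⟨ cong (∣E∣ G +_) (sumFin-comm (λ i j → e j i)) ⟩
  ∣E∣ G + ∣E∣ G                                      ≡⟨ cong (∣E∣ G +_) (ℕ.+-identityʳ (∣E∣ G)) ⟨
  2 * ∣E∣ G                                          ∎
  where
  open ≡-Reasoning
  e : Fin (n G) → Fin (n G) → ℕ
  e i j = if adj G i j then b2n (toℕ i <ᵇ toℕ j) else 0
  arc-split : ∀ i j → b2n (adj G i j) ≡ e i j + e j i
  arc-split i j with adj G i j in aᵢⱼ
  ... | false rewrite Graph.sym G j i | aᵢⱼ = refl
  ... | true  rewrite Graph.sym G j i | aᵢⱼ =
    sym (<ᵇ-connex (toℕ i) (toℕ j) (adj⇒≢ G aᵢⱼ ∘ Fin.toℕ-injective))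

deg≤Δ : (G : Graph) (v : Fin (n G)) → deg G v ≤ Δ G
deg≤Δ G = upper (deg G)
  where
  upper : ∀ {k} (f : Fin k → ℕ) i → f i ≤ maxFin f
  upper f zero    = ℕ.m≤m⊔n (f zero) _
  upper f (suc i) = ≤-trans (upper (f ∘ suc) i) (ℕ.m≤n⊔m (f zero) _)

Δ-least : (G : Graph) {c : ℕ} → (∀ v → deg G v ≤ c) → Δ G ≤ c
Δ-least G = least (deg G)
  where
  least : ∀ {k} (f : Fin k → ℕ) {c} → (∀ i → f i ≤ c) → maxFin f ≤ c
  least {zero}  f f≤c = z≤n
  least {suc k} f f≤c = ℕ.⊔-lub (f≤c zero) (least (f ∘ suc) (f≤c ∘ suc))

-- Relations with at most one edge

AtMostOneEdge : (Fin k → Fin k → Bool) → Set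
AtMostOneEdge R = ∀ {u v u′ v′} → R u v ≡ true → R u′ v′ ≡ true →
  (u ≡ u′ × v ≡ v′) ⊎ (u ≡ v′ × v ≡ u′)

module _ {R : Fin k → Fin k → Bool} (one : AtMostOneEdge R) where

  oneEdge-degree≤1 : ∀ u → count (R u) ≤ 1
  oneEdge-degree≤1 u = count-≤1 {P = R u} λ Ruw Ruw′ → case one Ruw Ruw′ of λ where
    (inj₁ (_ , w≡w′))   → w≡w′
    (inj₂ (u≡w′ , w≡u)) → trans w≡u u≡w′

  private
    endpoint : ∀ {u w u₀ w₀} → R u w ≡ true → R u₀ w₀ ≡ true → 1 ≤ [ u ≟ u₀ ] + [ u ≟ w₀ ]
    endpoint Ruw Ru₀w₀ = 1≤b2n+b2n (⊎-map (λ u≡u₀ → dec-true (_ ≟ _) (proj₁ u≡u₀))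
                                            (λ u≡w₀ → dec-true (_ ≟ _) (proj₁ u≡w₀)) (one Ruw Ru₀w₀))

    ≤-indicators : {f : Fin k → ℕ} (x y : Fin k) → (∀ a → f a ≤ [ a ≟ x ] + [ a ≟ y ]) → sumFin f ≤ 2
    ≤-indicators x y f≤ = ≤-trans (sumFin-mono f≤) (≤-reflexive (sumFin-indicators x y))

  oneEdge-endpoints : {P : Fin k → Bool} → (∀ {u} → P u ≡ true → ∃ λ w → R u w ≡ true) → count P ≤ 2
  oneEdge-endpoints {P} incident = count-≤-by-witness λ {u₀} Pu₀ →
    ≤-indicators u₀ _ (bound (proj₂ (incident Pu₀)))
    where
    bound : ∀ {u₀ w₀} → R u₀ w₀ ≡ true → ∀ u → b2n (P u) ≤ [ u ≟ u₀ ] + [ u ≟ w₀ ]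
    bound Ru₀w₀ u with P u in Pu
    ... | false = z≤n
    ... | true  = endpoint (proj₂ (incident Pu)) Ru₀w₀

  oneEdge-arcs≤2 : arcs R ≤ 2
  oneEdge-arcs≤2 = sumFin-≤-by-witness λ {u₀} 0<deg →
    ≤-indicators u₀ _ (bound (proj₂ (count-witness {P = R u₀} 0<deg)))
    where
    bound : ∀ {u₀ w₀} → R u₀ w₀ ≡ true → ∀ u → count (R u) ≤ [ u ≟ u₀ ] + [ u ≟ w₀ ]
    bound Ru₀w₀ u = count-≤-by-witness {P = R u} λ Ruw → ≤-trans (oneEdge-degree≤1 u) (endpoint Ruw Ru₀w₀)

  oneEdge-adjacent : ∀ {u v w w′} → u ≢ v → R u w ≡ true → R v w′ ≡ true → R u v ≡ true
  oneEdge-adjacent u≢v Ruw Rvw′ with one Ruw Rvw′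
  ... | inj₁ (u≡v , _)     = ⊥-elim (u≢v u≡v)
  ... | inj₂ (refl , refl) = Ruw

-- Connectivity

module _ {G : Graph} where

  Reach-trans : ∀ {u v w} → Reach G u v → Reach G v w → Reach G u w
  Reach-trans here        r = r
  Reach-trans (step a r′) r = step a (Reach-trans r′ r)

  Reach-sym : ∀ {u v} → Reach G u v → Reach G v u
  Reach-sym here               = here
  Reach-sym (step {u} {w} a r) = Reach-trans (Reach-sym r) (step (trans (Graph.sym G w u) a) here)

  walk⇒Reach : ∀ N (h : Fin (suc N) → Fin (n G)) → (∀ i → adj G (h (inject₁ i)) (h (suc i)) ≡ true) →
    Reach G (h zero) (h (fromℕ N))
  walk⇒Reach zero    h walk = here
  walk⇒Reach (suc N) h walk = step (walk zero) (walk⇒Reach N (h ∘ suc) (walk ∘ suc))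

  exit-edge : {X : Fin (n G) → Bool} {u v : Fin (n G)} → Reach G u v → X u ≡ true → X v ≡ false →
    ∃₂ λ x y → adj G x y ≡ true × X x ≡ true × X y ≡ false
  exit-edge here Xu Xv = case trans (sym Xu) Xv of λ ()
  exit-edge {X} (step {u} {w} a r) Xu Xv with X w in Xw
  ... | true  = exit-edge r Xw Xv
  ... | false = u , w , a , Xu , Xw

sameEdge : Fin k → Fin k → Fin k → Fin k → Bool
sameEdge p q a b = (does (a ≟ p) ∧ does (b ≟ q)) ∨ (does (a ≟ q) ∧ does (b ≟ p))

sameEdge-comm : (p q a b : Fin k) → sameEdge p q a b ≡ sameEdge p q b a
sameEdge-comm p q a b rewrite Bool.∧-comm (does (a ≟ p)) (does (b ≟ q))
                            | Bool.∧-comm (does (a ≟ q)) (does (b ≟ p)) =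
  Bool.∨-comm (does (b ≟ q) ∧ does (a ≟ p)) _

sameEdge-sound : (p q a b : Fin k) → sameEdge p q a b ≡ true → (a ≡ p × b ≡ q) ⊎ (a ≡ q × b ≡ p)
sameEdge-sound p q a b same with a ≟ p | b ≟ q | a ≟ q | b ≟ p
... | yes a≡p | yes b≡q | _       | _       = inj₁ (a≡p , b≡q)
... | yes _   | no _    | yes a≡q | yes b≡p = inj₂ (a≡q , b≡p)
... | no _    | _       | yes a≡q | yes b≡p = inj₂ (a≡q , b≡p)

sameEdge-refl : (p q : Fin k) → sameEdge p q p q ≡ true
sameEdge-refl p q rewrite dec-true (p ≟ p) refl | dec-true (q ≟ q) refl = refl

deleteEdge : (G : Graph) → Fin (n G) → Fin (n G) → Graph
deleteEdge G p q = record
  { n      = n G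
  ; adj    = λ a b → adj G a b ∧ not (sameEdge p q a b)
  ; sym    = λ a b → cong₂ _∧_ (Graph.sym G a b) (cong not (sameEdge-comm p q a b))
  ; irrefl = λ a → cong (_∧ _) (irrefl G a)
  }

arcs-deleteEdge : (G : Graph) {p q : Fin (n G)} → adj G p q ≡ true →
  2 + arcs (adj (deleteEdge G p q)) ≤ arcs (adj G)
arcs-deleteEdge G {p} {q} pq = arcs-missing-edge (adj⇒≢ G pq) (proj₁ ∘ ∧-true)
  pq (cong₂ (λ e s → e ∧ not s) pq (sameEdge-refl p q))
  qp (cong₂ (λ e s → e ∧ not s) qp (trans (sameEdge-comm p q q p) (sameEdge-refl p q)))
  where
  qp : adj G q p ≡ true
  qp = trans (Graph.sym G q p) pq

deleteEdge-connected : (G : Graph) {p q : Fin (n G)} → Connected G →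
  Reach (deleteEdge G p q) q p → Connected (deleteEdge G p q)
deleteEdge-connected G {p} {q} connected q⇝p u v = avoid (connected u v)
  where
  avoid : ∀ {u v} → Reach G u v → Reach (deleteEdge G p q) u v
  avoid here = here
  avoid (step {u} {w} a r) with sameEdge p q u w in same
  ... | false = step (cong₂ (λ e s → e ∧ not s) a same) (avoid r)
  ... | true with sameEdge-sound p q u w same
  ...   | inj₁ (refl , refl) = Reach-trans (Reach-sym q⇝p) (avoid r)
  ...   | inj₂ (refl , refl) = Reach-trans q⇝p (avoid r)

-- The rest of a cycle joins the ends of its closing edge.
cycle-edge : (G : Graph) → HasCycle G → ∃₂ λ p q → adj G p q ≡ true × Reach (deleteEdge G p q) q p
cycle-edge G (j , f , f-injective , consecutive , closing) =
  last , f zero , closing , walk⇒Reach (suc (suc j)) f (λ i → cong₂ (λ e s → e ∧ not s) (consecutive i) (not-closing i))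
  where
  last : Fin (n G)
  last = f (fromℕ (suc (suc j)))
  not-first-and-last : ∀ i → inject₁ i ≡ zero → suc i ≡ fromℕ (suc (suc j)) → ⊥
  not-first-and-last zero    _  ()
  not-first-and-last (suc i) () _
  not-closing : ∀ i → sameEdge last (f zero) (f (inject₁ i)) (f (suc i)) ≡ false
  not-closing i with sameEdge last (f zero) (f (inject₁ i)) (f (suc i)) in same
  ... | false = refl
  ... | true with sameEdge-sound _ _ (f (inject₁ i)) (f (suc i)) same
  ...   | inj₁ (i≡last , _)        = ⊥-elim (Fin.fromℕ≢inject₁ (sym (f-injective i≡last)))
  ...   | inj₂ (i≡first , 1+i≡last) = ⊥-elim (not-first-and-last i (f-injective i≡first) (f-injective 1+i≡last))

insert : (Fin k → Bool) → Fin k → Fin k → Bool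
insert X y a = X a ∨ does (a ≟ y)

count-not-insert : {X : Fin k → Bool} {y : Fin k} → X y ≡ false →
  count (not ∘ X) ≡ suc (count (not ∘ insert X y))
count-not-insert {X = X} {y} Xy = begin
  count (not ∘ X)                                   ≡⟨ sumFin-cong (λ a → at a (a ≟ y)) ⟩
  sumFin (λ a → [ a ≟ y ] + b2n (not (insert X y a))) ≡⟨ sumFin-distrib-+ (λ a → [ a ≟ y ]) _ ⟩
  sumFin (λ a → [ a ≟ y ]) + count (not ∘ insert X y) ≡⟨ cong (_+ count (not ∘ insert X y)) (sumFin-indicator y) ⟩
  suc (count (not ∘ insert X y))                      ∎
  where
  open ≡-Reasoning
  at : ∀ a → Dec (a ≡ y) → b2n (not (X a)) ≡ [ a ≟ y ] + b2n (not (insert X y a))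
  at a (yes refl) rewrite dec-true (a ≟ a) refl | Xy = refl
  at a (no a≢y)   rewrite dec-false (a ≟ y) a≢y | Bool.∨-identityʳ (X a) = refl

arcs-leaving-insert : (G : Graph) {X : Fin (n G) → Bool} {x y : Fin (n G)} →
  adj G x y ≡ true → X x ≡ true → X y ≡ false →
  2 + arcs (leaving (insert X y) (adj G)) ≤ arcs (leaving X (adj G))
arcs-leaving-insert G {X} {x} {y} xy Xx Xy = arcs-missing-edge (adj⇒≢ G xy) shrinks
  (cong₂ (λ e s → e ∧ not s) xy (cong₂ _∧_ Xx Xy)) (cong₂ (λ e s → e ∧ not s) xy (cong₂ _∧_ X′x X′y))
  (cong₂ (λ e s → e ∧ not s) yx (cong₂ _∧_ Xy Xx)) (cong₂ (λ e s → e ∧ not s) yx (cong₂ _∧_ X′y X′x))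
  where
  yx : adj G y x ≡ true
  yx = trans (Graph.sym G y x) xy
  X′x : insert X y x ≡ true
  X′x = cong (_∨ _) Xx
  X′y : insert X y y ≡ true
  X′y = trans (cong (X y ∨_) (dec-true (y ≟ y) refl)) (Bool.∨-zeroʳ (X y))
  shrinks : ∀ {a b} → leaving (insert X y) (adj G) a b ≡ true → leaving X (adj G) a b ≡ true
  shrinks {a} {b} ab = let (adj-ab , out) = ∧-true ab in
    cong₂ _∧_ adj-ab (not-∧-antitone {X a} {X b} (cong (_∨ does (a ≟ y))) (cong (_∨ does (b ≟ y))) out)

-- Grow X by one boundary vertex at a time.
arcs-leaving-connected : (G : Graph) → Connected G → {X : Fin (n G) → Bool} {r : Fin (n G)} →
  X r ≡ true → 2 * count (not ∘ X) ≤ arcs (leaving X (adj G))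
arcs-leaving-connected G connected {X} {r} Xr = grow _ X refl Xr
  where
  grow : ∀ c X → count (not ∘ X) ≡ c → X r ≡ true → 2 * c ≤ arcs (leaving X (adj G))
  grow zero    X _  _  = z≤n
  grow (suc c) X c≡ Xr =
    let (s , ¬Xs)             = count-witness {P = not ∘ X} (subst (0 <_) (sym c≡) z<s)
        (x , y , xy , Xx , Xy) = exit-edge {X = X} (connected r s) Xr (not≡true⇒≡false ¬Xs)
    in begin
      2 * suc c                                ≡⟨ ℕ.*-suc 2 c ⟩
      2 + 2 * c                                ≤⟨ +-monoʳ-≤ 2 (grow c (insert X y)
                                                    (ℕ.suc-injective (trans (sym (count-not-insert {X = X} Xy)) c≡))
                                                    (cong (_∨ does (r ≟ y)) Xr)) ⟩
      2 + arcs (leaving (insert X y) (adj G))  ≤⟨ arcs-leaving-insert G {X} xy Xx Xy ⟩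
      arcs (leaving X (adj G))                 ∎
    where open ℕ.≤-Reasoning

arcs-connected : (G : Graph) → Connected G → 2 * n G ≤ 2 + arcs (adj G)
arcs-connected record { n = zero }  connected = z≤n
arcs-connected G@record { n = suc k } connected = begin
  2 * suc k                              ≡⟨ cong (2 *_) (count-complement root) ⟨
  2 * (count root + count (not ∘ root))  ≡⟨ cong (λ c → 2 * (c + count (not ∘ root))) (sumFin-indicator {suc k} zero) ⟩
  2 * suc (count (not ∘ root))           ≡⟨ ℕ.*-suc 2 _ ⟩
  2 + 2 * count (not ∘ root)             ≤⟨ +-monoʳ-≤ 2 (arcs-leaving-connected G connected {root} {zero} refl) ⟩
  2 + arcs (leaving root (adj G))        ≤⟨ +-monoʳ-≤ 2 (arcs-mono {R = adj G} {leaving root (adj G)} (proj₁ ∘ ∧-true)) ⟩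
  2 + arcs (adj G)                       ∎
  where
  open ℕ.≤-Reasoning
  root : Fin (suc k) → Bool
  root a = does (a ≟ zero)

-- A connected graph on one or two vertices is P₁ or P₂.
In𝓗⇒3≤∣V∣ : (G : Graph) → In𝓗 G → 3 ≤ ∣V∣ G
In𝓗⇒3≤∣V∣ record { n = zero } G∈𝓗 = case In𝓗.nonempty G∈𝓗 of λ ()
In𝓗⇒3≤∣V∣ record { n = suc zero ; irrefl = irr } G∈𝓗 =
  ⊥-elim (In𝓗.notPath G∈𝓗 1 (s≤s z≤n) (s≤s z≤n) (↔-refl , λ { zero zero → sym (irr zero) }))
In𝓗⇒3≤∣V∣ record { n = suc (suc zero) ; sym = sym₀₁ ; irrefl = irr } G∈𝓗
  with In𝓗.connected G∈𝓗 zero (suc zero)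
... | step {w = zero}     a₀₀ _ = case trans (sym a₀₀) (irr zero) of λ ()
... | step {w = suc zero} a₀₁ _ = ⊥-elim (In𝓗.notPath G∈𝓗 2 (s≤s z≤n) (s≤s (s≤s z≤n)) (↔-refl , λ
  { zero       zero       → sym (irr zero)
  ; zero       (suc zero) → sym a₀₁
  ; (suc zero) zero       → sym (trans (sym₀₁ (suc zero) zero) a₀₁)
  ; (suc zero) (suc zero) → sym (irr (suc zero)) }))
In𝓗⇒3≤∣V∣ record { n = suc (suc (suc k)) } G∈𝓗 = s≤s (s≤s (s≤s z≤n))

connected-edge : (G : Graph) → Connected G → 2 ≤ n G → ∃₂ λ p q → adj G p q ≡ true
connected-edge record { n = suc zero } connected (s≤s ())
connected-edge record { n = suc (suc k) } connected _ with connected zero (suc zero)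
... | step {w = w} a _ = zero , w , a

In𝓗⇒4≤arcs : (G : Graph) → In𝓗 G → 4 ≤ arcs (adj G)
In𝓗⇒4≤arcs G G∈𝓗 = ℕ.+-cancelˡ-≤ 2 4 _
  (≤-trans (ℕ.*-monoʳ-≤ 2 (In𝓗⇒3≤∣V∣ G G∈𝓗)) (arcs-connected G (In𝓗.connected G∈𝓗)))

-- The colouring

pairCode : Fin k → Fin k → ℕ
pairCode a b = toℕ (combine a b) ⊔ toℕ (combine b a)

pairCode-comm : (a b : Fin k) → pairCode a b ≡ pairCode b a
pairCode-comm a b = ℕ.⊔-comm (toℕ (combine a b)) _

toℕ-combine-injective : (a b c d : Fin k) → toℕ (combine a b) ≡ toℕ (combine c d) → a ≡ c × b ≡ d
toℕ-combine-injective a b c d = Fin.combine-injective a b c d ∘ Fin.toℕ-injective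

pairCode-injective : (a b c d : Fin k) → pairCode a b ≡ pairCode c d → (a ≡ c × b ≡ d) ⊎ (a ≡ d × b ≡ c)
pairCode-injective a b c d same
  with ℕ.⊔-sel (toℕ (combine a b)) (toℕ (combine b a)) | ℕ.⊔-sel (toℕ (combine c d)) (toℕ (combine d c))
... | inj₁ ab | inj₁ cd = inj₁ (toℕ-combine-injective a b c d (trans (sym ab) (trans same cd)))
... | inj₁ ab | inj₂ dc = inj₂ (toℕ-combine-injective a b d c (trans (sym ab) (trans same dc)))
... | inj₂ ba | inj₁ cd =
  let (b≡c , a≡d) = toℕ-combine-injective b a c d (trans (sym ba) (trans same cd)) in inj₂ (a≡d , b≡c)
... | inj₂ ba | inj₂ dc =
  let (b≡d , a≡c) = toℕ-combine-injective b a d c (trans (sym ba) (trans same dc)) in inj₁ (a≡c , b≡d)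

-- The vertices of K_size are positions: inj₁ a is the vertex a of G and inj₂ (k , s) the
-- end s of the k-th new edge. The new edges get the colours toℕ k; that these may agree
-- with other colours does not matter, only that they differ from each other.
module Colouring (G : Graph) (p q : Fin (n G)) (t : ℕ) where

  Pos : Set
  Pos = Fin (n G) ⊎ (Fin t × Bool)

  size : ℕ
  size = n G + t * 2

  Fin↔Pos : Fin size ↔ Pos
  Fin↔Pos = ↔-trans Fin.+↔⊎ (↔-refl ⊎-↔ ↔-trans Fin.*↔× (↔-refl ×-↔ Fin.2↔Bool))

  pos : Fin size → Pos
  pos = Inverse.to Fin↔Pos

  place : Pos → Fin size
  place = Inverse.from Fin↔Pos

  place-injective : ∀ {x y} → place x ≡ place y → x ≡ y
  place-injective = Injection.injective (↔⇒↣ (↔-sym Fin↔Pos))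

  background : ℕ
  background = pairCode p q

  G∖pq : Graph
  G∖pq = deleteEdge G p q

  colour : Pos → Pos → ℕ
  colour (inj₁ a)       (inj₁ b)       = if adj G a b then pairCode a b else background
  colour (inj₂ (k , s)) (inj₂ (l , r)) = if does (k ≟ l) ∧ (s xor r) then toℕ k else background
  colour _              _              = background

  colour-comm : ∀ x y → colour x y ≡ colour y x
  colour-comm (inj₁ a)       (inj₁ b)       rewrite Graph.sym G a b | pairCode-comm a b = refl
  colour-comm (inj₂ (k , s)) (inj₂ (l , r)) with k ≟ l
  ... | yes refl rewrite dec-true (k ≟ k) refl | Bool.xor-comm s r = refl
  ... | no k≢l   rewrite dec-false (l ≟ k) (k≢l ∘ sym) = refl
  colour-comm (inj₁ _)       (inj₂ _)       = refl
  colour-comm (inj₂ _)       (inj₁ _)       = refl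

  C : Coloring size
  C = record { col = λ i j → colour (pos i) (pos j) ; colSym = λ i j → colour-comm (pos i) (pos j) }

  colour-place : ∀ x y → col C (place x) (place y) ≡ colour x y
  colour-place x y = cong₂ colour (Inverse.strictlyInverseˡ Fin↔Pos x) (Inverse.strictlyInverseˡ Fin↔Pos y)

  C-uses-t : UsesAtLeast C t
  C-uses-t = ends , (λ k same → case place-injective {inj₂ (k , false)} {inj₂ (k , true)} same of λ ()) ,
    λ k l same → Fin.toℕ-injective (trans (sym (new-colour k)) (trans same (new-colour l)))
    where
    ends : Fin t → Fin size × Fin size
    ends k = place (inj₂ (k , false)) , place (inj₂ (k , true))
    new-colour : ∀ k → col C (place (inj₂ (k , false))) (place (inj₂ (k , true))) ≡ toℕ k
    new-colour k rewrite colour-place (inj₂ (k , false)) (inj₂ (k , true)) | dec-true (k ≟ k) refl = refl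

  C-rainbow-G : RainbowCopy G C
  C-rainbow-G = place ∘ inj₁ , (λ {a} {b} same → Sum.inj₁-injective (place-injective {inj₁ a} {inj₁ b} same)) ,
    λ a b a′ b′ ab a′b′ same →
      pairCode-injective a b a′ b′ (trans (sym (edge-colour ab)) (trans same (edge-colour a′b′)))
    where
    edge-colour : ∀ {a b} → adj G a b ≡ true → col C (place (inj₁ a)) (place (inj₁ b)) ≡ pairCode a b
    edge-colour {a} {b} ab rewrite colour-place (inj₁ a) (inj₁ b) | ab = refl

  record RainbowEmbedding (H : Graph) : Set where
    field
      π           : Fin (n H) → Pos
      π-injective : ∀ {u v} → π u ≡ π v → u ≡ v
      rainbow     : ∀ u v u′ v′ → adj H u v ≡ true → adj H u′ v′ ≡ true →
                    colour (π u) (π v) ≡ colour (π u′) (π v′) → (u ≡ u′ × v ≡ v′) ⊎ (u ≡ v′ × v ≡ u′)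

  embedding : ∀ {H} → RainbowCopy H C → RainbowEmbedding H
  embedding (f , f-injective , f-rainbow) = record
    { π           = pos ∘ f
    ; π-injective = f-injective ∘ Injection.injective (↔⇒↣ Fin↔Pos)
    ; rainbow     = f-rainbow
    }

  _≟Pos_ : (x y : Pos) → Dec (x ≡ y)
  _≟Pos_ = Sum.≡-dec _≟_ (Prod.≡-dec _≟_ Bool._≟_)

  data Foreground : Pos → Pos → Set where
    graph-edge : ∀ {a b} → adj G∖pq a b ≡ true → Foreground (inj₁ a) (inj₁ b)
    new-edge   : ∀ k s → Foreground (inj₂ (k , s)) (inj₂ (k , not s))

  foreground : ∀ x y → colour x y ≢ background → Foreground x y
  foreground (inj₁ a) (inj₁ b) c≢bg with adj G a b in ab
  ... | false = ⊥-elim (c≢bg refl)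
  ... | true  = graph-edge (cong₂ (λ e s → e ∧ not s) ab (Bool.¬-not (c≢bg ∘ pq-coloured)))
    where
    pq-coloured : sameEdge p q a b ≡ true → pairCode a b ≡ background
    pq-coloured same with sameEdge-sound p q a b same
    ... | inj₁ (refl , refl) = refl
    ... | inj₂ (refl , refl) = pairCode-comm q p
  foreground (inj₂ (k , s)) (inj₂ (l , r)) c≢bg with k ≟ l | s xor r in s⊕r
  ... | yes refl | true  = subst (λ r → Foreground _ (inj₂ (k , r))) (xor-partner s r s⊕r) (new-edge k s)
    where
    xor-partner : ∀ s r → s xor r ≡ true → not s ≡ r
    xor-partner false true  _ = refl
    xor-partner true  false _ = refl
  ... | yes refl | false = ⊥-elim (c≢bg refl)
  ... | no _     | _     = ⊥-elim (c≢bg refl)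
  foreground (inj₁ _) (inj₂ _) c≢bg = ⊥-elim (c≢bg refl)
  foreground (inj₂ _) (inj₁ _) c≢bg = ⊥-elim (c≢bg refl)

  graph-neighbour : ∀ {a y} → Foreground (inj₁ a) y → ∃ λ b → y ≡ inj₁ b × adj G∖pq a b ≡ true
  graph-neighbour (graph-edge ab) = _ , refl , ab

  other-end : ∀ {k s y} → Foreground (inj₂ (k , s)) y → y ≡ inj₂ (k , not s)
  other-end (new-edge k s) = refl

  Closed : (Pos → Bool) → Set
  Closed Y = ∀ {x y} → Foreground x y → Y x ≡ true → Y y ≡ true

  inGraph : Pos → Bool
  inGraph (inj₁ _) = true
  inGraph (inj₂ _) = false

  inGraph-sound : ∀ {y} → inGraph y ≡ true → ∃ λ a → y ≡ inj₁ a
  inGraph-sound {inj₁ a} _ = a , refl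

  inGraph-closed : Closed inGraph
  inGraph-closed (graph-edge _) _ = refl

  samePair : Pos → Pos → Bool
  samePair (inj₂ (k , _)) (inj₂ (l , _)) = does (k ≟ l)
  samePair _              _              = false

  samePair-closed : ∀ z → Closed (samePair z)
  samePair-closed (inj₂ _) (new-edge k s) same = same

  samePair-refl : ∀ {x} → inGraph x ≡ false → samePair x x ≡ true
  samePair-refl {inj₂ (k , _)} _ = dec-true (k ≟ k) refl

  samePair-inGraph : ∀ {x y} → inGraph y ≡ true → samePair x y ≡ false
  samePair-inGraph {inj₁ _}          _ = refl
  samePair-inGraph {inj₂ _} {inj₁ _} _ = refl

  samePair-sound : ∀ {x y} → samePair x y ≡ true → ∃₂ λ k s → ∃ λ r → x ≡ inj₂ (k , s) × y ≡ inj₂ (k , r)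
  samePair-sound {inj₂ (k , s)} {inj₂ (l , r)} same with k ≟ l
  ... | yes refl = k , s , r , refl , refl

  samePair-sym : ∀ {x y} → samePair x y ≡ true → samePair y x ≡ true
  samePair-sym {x} {y} same with samePair-sound {x} {y} same
  ... | _ , _ , _ , refl , refl = same

  samePair-trans : ∀ {x y z} → samePair x y ≡ true → samePair y z ≡ true → samePair x z ≡ true
  samePair-trans {x} {y} {z} xy yz with samePair-sound {x} {y} xy | samePair-sound {y} {z} yz
  ... | _ , _ , _ , refl , refl | _ , _ , _ , refl , refl = yz

  side : Pos → Bool
  side (inj₁ _)       = false
  side (inj₂ (_ , s)) = s

  samePair-side : ∀ {z x y} → samePair z x ≡ true → samePair z y ≡ true → side x ≡ side y → x ≡ y
  samePair-side {z} {x} {y} zx zy sides with samePair-sound {z} {x} zx | samePair-sound {z} {y} zy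
  ... | _ , _ , _ , refl , refl | _ , _ , _ , refl , refl = cong (λ s → inj₂ (_ , s)) sides

-- Rainbow copies in the colouring

module Shape (G : Graph) {p q : Fin (n G)} (pq : adj G p q ≡ true) (t : ℕ)
  (H : Graph) (H-connected : Connected H) (E : Colouring.RainbowEmbedding G p q t H) where

  open Colouring G p q t
  open RainbowEmbedding E

  isBackground : Fin (n H) → Fin (n H) → Bool
  isBackground u v = does (colour (π u) (π v) ℕ.≟ background)

  bgAdj fgAdj : Fin (n H) → Fin (n H) → Bool
  bgAdj u v = adj H u v ∧ isBackground u v
  fgAdj u v = adj H u v ∧ not (isBackground u v)

  bgAdj-one : AtMostOneEdge bgAdj
  bgAdj-one {u} {v} {u′} {v′} uv u′v′ =
    let (a , b) = ∧-true uv ; (a′ , b′) = ∧-true u′v′ in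
    rainbow u v u′ v′ a a′ (trans (does-sound (_ ℕ.≟ _) b) (sym (does-sound (_ ℕ.≟ _) b′)))

  fgAdj-foreground : ∀ {u v} → fgAdj u v ≡ true → Foreground (π u) (π v)
  fgAdj-foreground {u} {v} uv = foreground (π u) (π v) λ c≡bg →
    case trans (sym (proj₂ (∧-true uv))) (cong not (dec-true (colour (π u) (π v) ℕ.≟ background) c≡bg)) of λ ()

  deg-split : ∀ u → deg H u ≡ count (bgAdj u) + count (fgAdj u)
  deg-split u = trans (sumFin-cong (λ w → b2n-split (adj H u w) (isBackground u w)))
                      (sumFin-distrib-+ (λ w → b2n (bgAdj u w)) _)

  escape : ∀ {Y} → Closed Y → ∀ w v → Y (π w) ≡ true → Y (π v) ≡ false →
    ∃₂ λ x y → bgAdj x y ≡ true × Y (π x) ≡ true × Y (π y) ≡ false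
  escape {Y} closed w v Yw Yv with exit-edge {X = Y ∘ π} (H-connected w v) Yw Yv
  ... | x , y , xy , Yx , Yy with isBackground x y in bg
  ... | true  = x , y , cong₂ _∧_ xy bg , Yx , Yy
  ... | false = case trans (sym (closed (fgAdj-foreground (cong₂ (λ e b → e ∧ not b) xy bg)) Yx)) Yy of λ ()

  samePair-count : ∀ z → count (λ w → samePair z (π w)) ≤ 2
  samePair-count z = count-injection {Q = λ (_ : Fin 2) → true} (λ w → Inverse.from Fin.2↔Bool (side (π w)))
    (λ _ → refl)
    (λ {w} {w′} zw zw′ same → π-injective (samePair-side {z} {π w} {π w′} zw zw′
      (Injection.injective (↔⇒↣ (↔-sym Fin.2↔Bool)) same)))

  pair-meets-background : ∀ {x₀ y₀} → bgAdj x₀ y₀ ≡ true → ∀ w v → inGraph (π w) ≡ false →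
    samePair (π w) (π v) ≡ false → samePair (π w) (π x₀) ≡ true ⊎ samePair (π w) (π y₀) ≡ true
  pair-meets-background bg₀ w v Bw wv
    with escape (samePair-closed (π w)) w v (samePair-refl {π w} Bw) wv
  ... | x , y , bg , wx , _ with bgAdj-one bg bg₀
  ... | inj₁ (refl , _) = inj₁ wx
  ... | inj₂ (refl , _) = inj₂ wx

  pairVertices : ℕ
  pairVertices = count (λ w → not (inGraph (π w)))

  -- The background edge leaves G at a vertex y₀ on a new edge, and every new edge met by H contains y₀.
  pairVertices≤2 : ∀ u₀ → inGraph (π u₀) ≡ true → pairVertices ≤ 2
  pairVertices≤2 u₀ Gu₀ = count-≤-by-witness λ {w₀} Bw₀ →
    let (x₀ , y₀ , bg₀ , Gx₀ , _) = escape inGraph-closed u₀ w₀ Gu₀ (not≡true⇒≡false Bw₀) in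
    ≤-trans (count-mono (λ {w} Bw → pair-of-y₀ bg₀ Gx₀ w (not≡true⇒≡false Bw))) (samePair-count (π y₀))
    where
    pair-of-y₀ : ∀ {x₀ y₀} → bgAdj x₀ y₀ ≡ true → inGraph (π x₀) ≡ true → ∀ w → inGraph (π w) ≡ false →
      samePair (π y₀) (π w) ≡ true
    pair-of-y₀ {x₀} {y₀} bg₀ Gx₀ w Bw with pair-meets-background bg₀ w u₀ Bw (samePair-inGraph {π w} Gu₀)
    ... | inj₁ wx₀ = case trans (sym wx₀) (samePair-inGraph {π w} Gx₀) of λ ()
    ... | inj₂ wy₀ = samePair-sym {π w} {π y₀} wy₀

  -- Either H lies on the new edge of w₀, or every new edge met by H contains an end of the background edge.
  pairVertices≤4 : pairVertices ≤ 4
  pairVertices≤4 = count-≤-by-witness λ {w₀} Bw₀ →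
    case any? (λ v → samePair (π w₀) (π v) Bool.≟ false) of λ where
      (no all-in-pair) → ≤-trans (count-mono (λ {w} _ → Bool.¬-not (λ out → all-in-pair (w , out))))
                                 (ℕ.m≤n⇒m≤o+n 2 (samePair-count (π w₀)))
      (yes (v₁ , w₀v₁)) →
        let (x₀ , y₀ , bg₀ , _ , _) =
              escape (samePair-closed (π w₀)) w₀ v₁ (samePair-refl {π w₀} (not≡true⇒≡false Bw₀)) w₀v₁ in
        begin
          pairVertices
            ≤⟨ sumFin-mono (two-pairs bg₀ w₀ v₁ w₀v₁) ⟩
          sumFin (λ w → b2n (samePair (π x₀) (π w)) + b2n (samePair (π y₀) (π w)))
            ≡⟨ sumFin-distrib-+ (λ w → b2n (samePair (π x₀) (π w))) _ ⟩
          count (λ w → samePair (π x₀) (π w)) + count (λ w → samePair (π y₀) (π w))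
            ≤⟨ +-mono-≤ (samePair-count (π x₀)) (samePair-count (π y₀)) ⟩
          4 ∎
    where
    open ℕ.≤-Reasoning
    two-pairs : ∀ {x₀ y₀} → bgAdj x₀ y₀ ≡ true → ∀ w₀ v₁ → samePair (π w₀) (π v₁) ≡ false → ∀ w →
      b2n (not (inGraph (π w))) ≤ b2n (samePair (π x₀) (π w)) + b2n (samePair (π y₀) (π w))
    two-pairs {x₀} {y₀} bg₀ w₀ v₁ w₀v₁ w with inGraph (π w) in Gw
    ... | true  = z≤n
    ... | false = let (v , wv) = outside in
      1≤b2n+b2n (⊎-map (samePair-sym {π w} {π x₀}) (samePair-sym {π w} {π y₀}) (pair-meets-background bg₀ w v Gw wv))
      where
      outside : ∃ λ v → samePair (π w) (π v) ≡ false
      outside with samePair (π w) (π w₀) in ww₀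
      ... | false = w₀ , ww₀
      ... | true  = v₁ , Bool.¬-not λ wv₁ →
        case trans (sym (samePair-trans {π w₀} {π w} {π v₁} (samePair-sym {π w} {π w₀} ww₀) wv₁)) w₀v₁ of λ ()

  graphVertices : ℕ
  graphVertices = count (λ u → inGraph (π u))

  graphVertices+pairVertices : graphVertices + pairVertices ≡ n H
  graphVertices+pairVertices = count-complement (λ u → inGraph (π u))

  graphVertices≤∣V∣ : graphVertices ≤ n G
  graphVertices≤∣V∣ = ≤-trans (count-injection {Q = λ _ → true} (λ u → ρ (π u)) (λ _ → refl) injective)
                              (≤-reflexive (count-all (n G)))
    where
    ρ : Pos → Fin (n G)
    ρ = fromInj₁ (λ _ → p)
    injective : ∀ {u v} → inGraph (π u) ≡ true → inGraph (π v) ≡ true → ρ (π u) ≡ ρ (π v) → u ≡ v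
    injective {u} {v} Gu Gv same with inGraph-sound Gu | inGraph-sound Gv
    ... | a , πu | b , πv =
      π-injective (trans πu (trans (cong inj₁ (trans (sym (cong ρ πu)) (trans same (cong ρ πv)))) (sym πv)))

  graph-vertex? : (∃ λ u → inGraph (π u) ≡ true) ⊎ (∀ u → inGraph (π u) ≡ false)
  graph-vertex? with any? (λ u → inGraph (π u) Bool.≟ true)
  ... | yes found = inj₁ found
  ... | no  none  = inj₂ (λ u → Bool.¬-not (λ Gu → none (u , Gu)))

  inImage : Fin (n G) → Bool
  inImage a = does (any? λ u → π u ≟Pos inj₁ a)

  inImage-intro : ∀ {u a} → π u ≡ inj₁ a → inImage a ≡ true
  inImage-intro {u} {a} πu = dec-true (any? λ u → π u ≟Pos inj₁ a) (u , πu)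

  image≤graphVertices : Fin (n H) → count inImage ≤ graphVertices
  image≤graphVertices u₀ = count-injection (λ a → preimage a (any? λ u → π u ≟Pos inj₁ a))
    (λ {a} Xa → cong inGraph (preimage-sound a _ Xa))
    (λ {a} {b} Xa Xb same → Sum.inj₁-injective
      (trans (sym (preimage-sound a _ Xa)) (trans (cong π same) (preimage-sound b _ Xb))))
    where
    preimage : ∀ a → Dec (∃ λ u → π u ≡ inj₁ a) → Fin (n H)
    preimage a (yes (u , _)) = u
    preimage a (no _)        = u₀
    preimage-sound : ∀ a d → does d ≡ true → π (preimage a d) ≡ inj₁ a
    preimage-sound a (yes (u , πu)) _ = πu

  imageDegree : Pos → ℕ
  imageDegree (inj₁ a) = count (inside inImage (adj G∖pq) a)
  imageDegree (inj₂ _) = 0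

  imageDegree-inGraph : ∀ {y} → 0 < imageDegree y → inGraph y ≡ true
  imageDegree-inGraph {inj₁ a} _ = refl

  imageDegree-pair : ∀ {y} → inGraph y ≡ false → imageDegree y ≡ 0
  imageDegree-pair {inj₂ _} _ = refl

  fgBound : Pos → ℕ
  fgBound y = imageDegree y + b2n (not (inGraph y))

  fg-degree : ∀ u → count (fgAdj u) ≤ fgBound (π u)
  fg-degree u = at (π u) refl
    where
    at : ∀ y → π u ≡ y → count (fgAdj u) ≤ fgBound y
    at (inj₁ a) πu = ≤-trans (count-injection ρ lands injective) (≤-reflexive (sym (ℕ.+-identityʳ _)))
      where
      ρ : Fin (n H) → Fin (n G)
      ρ w = fromInj₁ (λ _ → a) (π w)
      neighbour : ∀ {w} → fgAdj u w ≡ true → ∃ λ b → π w ≡ inj₁ b × adj G∖pq a b ≡ true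
      neighbour {w} uw = graph-neighbour (subst (λ x → Foreground x (π w)) πu (fgAdj-foreground uw))
      lands : ∀ {w} → fgAdj u w ≡ true → inside inImage (adj G∖pq) a (ρ w) ≡ true
      lands {w} uw with neighbour uw
      ... | b , πw , ab rewrite πw = cong₂ _∧_ ab (cong₂ _∧_ (inImage-intro πu) (inImage-intro πw))
      injective : ∀ {w w′} → fgAdj u w ≡ true → fgAdj u w′ ≡ true → ρ w ≡ ρ w′ → w ≡ w′
      injective uw uw′ same with neighbour uw | neighbour uw′
      ... | b , πw , _ | b′ , πw′ , _ rewrite πw | πw′ =
        π-injective (trans πw (trans (cong inj₁ same) (sym πw′)))
    at (inj₂ (k , s)) πu = count-≤1 {P = fgAdj u} λ uw uw′ → π-injective (trans (end uw) (sym (end uw′)))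
      where
      end : ∀ {w} → fgAdj u w ≡ true → π w ≡ inj₂ (k , not s)
      end {w} uw = other-end (subst (λ x → Foreground x (π w)) πu (fgAdj-foreground uw))

  deg-bound : ∀ u → deg H u ≤ count (bgAdj u) + fgBound (π u)
  deg-bound u = ≤-trans (≤-reflexive (deg-split u)) (+-monoʳ-≤ (count (bgAdj u)) (fg-degree u))

  deg≤bg+Δ : ∀ u → deg H u ≤ count (bgAdj u) + Δ G
  deg≤bg+Δ u = ≤-trans (deg-bound u) (+-monoʳ-≤ (count (bgAdj u)) (at (π u)))
    where
    at : ∀ y → fgBound y ≤ Δ G
    at (inj₁ a) = begin
      count (inside inImage (adj G∖pq) a) + 0 ≡⟨ ℕ.+-identityʳ _ ⟩
      count (inside inImage (adj G∖pq) a)     ≤⟨ count-mono {P = inside inImage (adj G∖pq) a} {adj G a}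
                                                   (proj₁ ∘ ∧-true ∘ proj₁ ∘ ∧-true) ⟩
      deg G a                                 ≤⟨ deg≤Δ G a ⟩
      Δ G                                     ∎
      where open ℕ.≤-Reasoning
    at (inj₂ _) = ≤-trans (count-positive {P = adj G p} pq) (deg≤Δ G p)

  Δ≤Δ+1 : Δ H ≤ Δ G + 1
  Δ≤Δ+1 = Δ-least H λ u → ≤-trans (deg≤bg+Δ u)
    (≤-trans (+-monoˡ-≤ (Δ G) (oneEdge-degree≤1 bgAdj-one u)) (≤-reflexive (ℕ.+-comm 1 (Δ G))))

  maxDegree⇒bg : ∀ u → deg H u ≡ Δ G + 1 → ∃ λ w → bgAdj u w ≡ true
  maxDegree⇒bg u du = count-witness {P = bgAdj u} (ℕ.+-cancelʳ-≤ (Δ G) 1 (count (bgAdj u)) (begin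
    1 + Δ G               ≡⟨ ℕ.+-comm 1 (Δ G) ⟩
    Δ G + 1               ≡⟨ du ⟨
    deg H u               ≤⟨ deg≤bg+Δ u ⟩
    count (bgAdj u) + Δ G ∎))
    where open ℕ.≤-Reasoning

  maxDegree-count≤2 : Δ H ≡ Δ G + 1 → countDeg H (Δ H) ≤ 2
  maxDegree-count≤2 ΔH≡ = oneEdge-endpoints bgAdj-one λ {v} dv →
    maxDegree⇒bg v (trans (does-sound (deg H v ℕ.≟ Δ H) dv) ΔH≡)

  maxDegree-adjacent : ∀ u v → u ≢ v → deg H u ≡ Δ G + 1 → deg H v ≡ Δ G + 1 → adj H u v ≡ true
  maxDegree-adjacent u v u≢v du dv = proj₁ (∧-true
    (oneEdge-adjacent bgAdj-one u≢v (proj₂ (maxDegree⇒bg u du)) (proj₂ (maxDegree⇒bg v dv))))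

  imageDegree-sum : sumFin (λ u → imageDegree (π u)) ≤ arcs (inside inImage (adj G∖pq))
  imageDegree-sum = sumFin-injection (λ u → ρ (π u)) (λ u → imageDegree (π u)) _ (λ u → at (π u)) injective
    where
    ρ : Pos → Fin (n G)
    ρ = fromInj₁ (λ _ → p)
    at : ∀ y → imageDegree y ≤ count (inside inImage (adj G∖pq) (ρ y))
    at (inj₁ a) = ≤-refl
    at (inj₂ _) = z≤n
    injective : ∀ {u v} → 0 < imageDegree (π u) → 0 < imageDegree (π v) → ρ (π u) ≡ ρ (π v) → u ≡ v
    injective {u} {v} du dv same
      with inGraph-sound (imageDegree-inGraph {π u} du) | inGraph-sound (imageDegree-inGraph {π v} dv)
    ... | a , πu | b , πv =
      π-injective (trans πu (trans (cong inj₁ (trans (sym (cong ρ πu)) (trans same (cong ρ πv)))) (sym πv)))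

  arcs≤2+image+pairs : arcs (adj H) ≤ 2 + (sumFin (λ u → imageDegree (π u)) + pairVertices)
  arcs≤2+image+pairs = begin
    arcs (adj H)                                                ≤⟨ sumFin-mono deg-bound ⟩
    sumFin (λ u → count (bgAdj u) + fgBound (π u))              ≡⟨ sumFin-distrib-+ (λ u → count (bgAdj u)) _ ⟩
    arcs bgAdj + sumFin (λ u → fgBound (π u))                   ≡⟨ cong (arcs bgAdj +_) (sumFin-distrib-+ (λ u → imageDegree (π u)) _) ⟩
    arcs bgAdj + (sumFin (λ u → imageDegree (π u)) + pairVertices) ≤⟨ +-monoˡ-≤ _ (oneEdge-arcs≤2 bgAdj-one) ⟩
    2 + (sumFin (λ u → imageDegree (π u)) + pairVertices)       ∎
    where open ℕ.≤-Reasoning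

  ∣V∣≤∣V∣+2 : 2 ≤ n G → n H ≤ n G + 2
  ∣V∣≤∣V∣+2 2≤∣V∣ = ≤-trans (≤-reflexive (sym graphVertices+pairVertices)) (case graph-vertex? of λ where
    (inj₁ (u₀ , Gu₀)) → +-mono-≤ graphVertices≤∣V∣ (pairVertices≤2 u₀ Gu₀)
    (inj₂ none)       → begin
      graphVertices + pairVertices ≡⟨ cong (_+ pairVertices) (count-none none) ⟩
      pairVertices                 ≤⟨ pairVertices≤4 ⟩
      4                            ≤⟨ +-monoˡ-≤ 2 2≤∣V∣ ⟩
      n G + 2                      ∎)
    where open ℕ.≤-Reasoning

  arcs≤arcs+2 : 4 ≤ arcs (adj G) → arcs (adj H) ≤ arcs (adj G) + 2
  arcs≤arcs+2 4≤arcs = ≤-trans arcs≤2+image+pairs (case graph-vertex? of λ where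
    (inj₁ (u₀ , Gu₀)) → begin
      2 + (sumFin (λ u → imageDegree (π u)) + pairVertices) ≤⟨ +-monoʳ-≤ 2 (+-mono-≤ image≤arcs (pairVertices≤2 u₀ Gu₀)) ⟩
      2 + (arcs (adj G∖pq) + 2)                             ≡⟨ ℕ.+-assoc 2 _ 2 ⟨
      2 + arcs (adj G∖pq) + 2                               ≤⟨ +-monoˡ-≤ 2 (arcs-deleteEdge G pq) ⟩
      arcs (adj G) + 2                                      ∎
    (inj₂ none) → begin
      2 + (sumFin (λ u → imageDegree (π u)) + pairVertices) ≡⟨ cong (λ s → 2 + (s + pairVertices)) (no-image none) ⟩
      2 + pairVertices                                      ≤⟨ +-monoʳ-≤ 2 pairVertices≤4 ⟩
      6                                                     ≤⟨ +-monoˡ-≤ 2 4≤arcs ⟩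
      arcs (adj G) + 2                                      ∎)
    where
    open ℕ.≤-Reasoning
    image≤arcs : sumFin (λ u → imageDegree (π u)) ≤ arcs (adj G∖pq)
    image≤arcs = ≤-trans imageDegree-sum (arcs-mono {R = adj G∖pq} {inside inImage (adj G∖pq)} (proj₁ ∘ ∧-true))
    no-image : (∀ u → inGraph (π u) ≡ false) → sumFin (λ u → imageDegree (π u)) ≡ 0
    no-image none = sumFin-zero (λ u → imageDegree-pair (none u))

  arcs+2∣V∣≤arcs+2∣V∣ : Connected G∖pq → arcs (adj H) + 2 * n G ≤ arcs (adj G) + 2 * n H
  arcs+2∣V∣≤arcs+2∣V∣ G∖pq-connected with graph-vertex?
  ... | inj₁ (u₀ , Gu₀) = let (a₀ , πu₀) = inGraph-sound Gu₀ in begin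
    arcs (adj H) + 2 * n G            ≤⟨ +-mono-≤ (≤-trans arcs≤2+image+pairs (+-monoʳ-≤ 2 (+-monoˡ-≤ B imageDegree-sum)))
                                                  (≤-reflexive (cong (2 *_) (sym (count-complement inImage)))) ⟩
    2 + (I + B) + 2 * (X + X̅)         ≡⟨ rearrange I B X X̅ ⟩
    2 + (I + 2 * X̅) + (B + 2 * X)     ≤⟨ +-mono-≤ (+-monoʳ-≤ 2 (+-monoʳ-≤ I (arcs-leaving-connected G∖pq G∖pq-connected (inImage-intro πu₀))))
                                                  (+-monoʳ-≤ B (ℕ.*-monoʳ-≤ 2 (image≤graphVertices u₀))) ⟩
    2 + (I + L) + (B + 2 * A)         ≡⟨ cong (λ e → 2 + e + (B + 2 * A)) (arcs-inside+leaving inImage (adj G∖pq)) ⟩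
    2 + arcs (adj G∖pq) + (B + 2 * A) ≤⟨ +-mono-≤ (arcs-deleteEdge G pq) (+-monoˡ-≤ (2 * A) (ℕ.m≤n*m B 2)) ⟩
    arcs (adj G) + (2 * B + 2 * A)    ≡⟨ cong (arcs (adj G) +_) (trans (sym (ℕ.*-distribˡ-+ 2 B A))
                                           (cong (2 *_) (trans (ℕ.+-comm B A) graphVertices+pairVertices))) ⟩
    arcs (adj G) + 2 * n H            ∎
    where
    open ℕ.≤-Reasoning
    I L X X̅ A B : ℕ
    I = arcs (inside inImage (adj G∖pq))
    L = arcs (leaving inImage (adj G∖pq))
    X = count inImage
    X̅ = count (not ∘ inImage)
    A = graphVertices
    B = pairVertices
    rearrange : ∀ i b x x̅ → 2 + (i + b) + 2 * (x + x̅) ≡ 2 + (i + 2 * x̅) + (b + 2 * x)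
    rearrange = solve 4 (λ i b x x̅ → con 2 :+ (i :+ b) :+ con 2 :* (x :+ x̅)
                                  := con 2 :+ (i :+ con 2 :* x̅) :+ (b :+ con 2 :* x)) refl
  ... | inj₂ none = begin
    arcs (adj H) + 2 * n G                         ≤⟨ +-mono-≤ (sumFin-mono deg≤2) (arcs-connected G∖pq G∖pq-connected) ⟩
    sumFin {n H} (λ _ → 2) + (2 + arcs (adj G∖pq)) ≤⟨ +-monoʳ-≤ _ (arcs-deleteEdge G pq) ⟩
    sumFin {n H} (λ _ → 2) + arcs (adj G)          ≡⟨ cong (_+ arcs (adj G)) (trans (sumFin-const (n H) 2) (ℕ.*-comm (n H) 2)) ⟩
    2 * n H + arcs (adj G)                         ≡⟨ ℕ.+-comm (2 * n H) _ ⟩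
    arcs (adj G) + 2 * n H                         ∎
    where
    open ℕ.≤-Reasoning
    deg≤2 : ∀ u → deg H u ≤ 2
    deg≤2 u = begin
      deg H u                            ≤⟨ deg-bound u ⟩
      count (bgAdj u) + fgBound (π u)    ≡⟨ cong₂ (λ d g → count (bgAdj u) + (d + b2n (not g))) (imageDegree-pair (none u)) (none u) ⟩
      count (bgAdj u) + 1                ≤⟨ +-monoˡ-≤ 1 (oneEdge-degree≤1 bgAdj-one u) ⟩
      2                                  ∎

-- Edges and dimension

dim-mono : (A B : Graph) → ∣E∣ A + ∣V∣ B ≤ ∣E∣ B + ∣V∣ A → dim A ≤ℤ dim B
dim-mono A B le = ℤ.+-monoˡ-≤ (ℤ.+ 1) (begin
  ℤ.+ eA ℤ.- ℤ.+ nA         ≡⟨ ℤ.m-n≡m⊖n eA nA ⟩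
  eA ⊖ nA                   ≡⟨ ℤ.+-cancelˡ-⊖ nB eA nA ⟨
  (nB + eA) ⊖ (nB + nA)     ≤⟨ ℤ.⊖-monoˡ-≤ (nB + nA) (subst₂ _≤_ (ℕ.+-comm eA nB) (ℕ.+-comm eB nA) le) ⟩
  (nA + eB) ⊖ (nB + nA)     ≡⟨ cong ((nA + eB) ⊖_) (ℕ.+-comm nB nA) ⟩
  (nA + eB) ⊖ (nA + nB)     ≡⟨ ℤ.+-cancelˡ-⊖ nA eB nB ⟩
  eB ⊖ nB                   ≡⟨ ℤ.m-n≡m⊖n eB nB ⟨
  ℤ.+ eB ℤ.- ℤ.+ nB         ∎)
  where
  open ℤ.≤-Reasoning
  eA nA eB nB : ℕ
  eA = ∣E∣ A ; nA = ∣V∣ A ; eB = ∣E∣ B ; nB = ∣V∣ B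

∣E∣≤∣E∣+1 : (A B : Graph) → arcs (adj A) ≤ arcs (adj B) + 2 → ∣E∣ A ≤ ∣E∣ B + 1
∣E∣≤∣E∣+1 A B le = ℕ.*-cancelˡ-≤ 2 (begin
  2 * ∣E∣ A           ≡⟨ handshake A ⟨
  arcs (adj A)        ≤⟨ le ⟩
  arcs (adj B) + 2    ≡⟨ cong (_+ 2) (handshake B) ⟩
  2 * ∣E∣ B + 2 * 1   ≡⟨ ℕ.*-distribˡ-+ 2 (∣E∣ B) 1 ⟨
  2 * (∣E∣ B + 1)     ∎)
  where open ℕ.≤-Reasoning

dim≤dim : (A B : Graph) → arcs (adj A) + 2 * ∣V∣ B ≤ arcs (adj B) + 2 * ∣V∣ A → dim A ≤ℤ dim B
dim≤dim A B le = dim-mono A B (ℕ.*-cancelˡ-≤ 2 (begin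
  2 * (∣E∣ A + ∣V∣ B)       ≡⟨ ℕ.*-distribˡ-+ 2 (∣E∣ A) (∣V∣ B) ⟩
  2 * ∣E∣ A + 2 * ∣V∣ B     ≡⟨ cong (_+ 2 * ∣V∣ B) (handshake A) ⟨
  arcs (adj A) + 2 * ∣V∣ B  ≤⟨ le ⟩
  arcs (adj B) + 2 * ∣V∣ A  ≡⟨ cong (_+ 2 * ∣V∣ A) (handshake B) ⟩
  2 * ∣E∣ B + 2 * ∣V∣ A     ≡⟨ ℕ.*-distribˡ-+ 2 (∣E∣ B) (∣V∣ A) ⟨
  2 * (∣E∣ B + ∣V∣ A)       ∎))
  where open ℕ.≤-Reasoning

≼⇒rainbow : {H₁ H₂ : Graph} (H₁≼H₂ : H₁ ≼ H₂) {p q : Fin (n H₂)} →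
  ¬ ¬ Colouring.RainbowEmbedding H₂ p q (proj₁ H₁≼H₂) H₁
≼⇒rainbow {H₁} {H₂} (t , _ , free⇒free) {p} {q} no-copy =
  free⇒free size C C-uses-t (no-copy ∘ embedding) C-rainbow-G
  where open Colouring H₂ p q t

theorem2 : (H₁ H₂ : Graph) → In𝓗 H₁ → In𝓗 H₂ → H₁ ≼ H₂ →
    (∣E∣ H₁ ≤ ∣E∣ H₂ + 1) ×
    (∣V∣ H₁ ≤ ∣V∣ H₂ + 2) ×
    ((Δ H₁ ≤ Δ H₂ + 1) ×
     (Δ H₁ ≡ Δ H₂ + 1 → countDeg H₁ (Δ H₁) ≤ 2) ×
     (∀ (u v : Fin (n H₁)) → u ≢ v → deg H₁ u ≡ Δ H₂ + 1 → deg H₁ v ≡ Δ H₂ + 1 →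
        adj H₁ u v ≡ true)) ×
    (¬ IsTree H₂ → dim H₁ ≤ℤ dim H₂)
theorem2 H₁ H₂ H₁∈𝓗 H₂∈𝓗 H₁≼H₂@(t , _) =
    via-copy (_ ℕ.≤? _) (λ E → ∣E∣≤∣E∣+1 H₁ H₂ (S.arcs≤arcs+2 E (In𝓗⇒4≤arcs H₂ H₂∈𝓗)))
  , via-copy (_ ℕ.≤? _) (λ E → S.∣V∣≤∣V∣+2 E 2≤∣V∣)
  , ( via-copy (_ ℕ.≤? _) S.Δ≤Δ+1
    , (λ ΔH₁≡ → via-copy (_ ℕ.≤? _) (λ E → S.maxDegree-count≤2 E ΔH₁≡))
    , (λ u v u≢v du dv → via-copy (adj H₁ u v Bool.≟ true) (λ E → S.maxDegree-adjacent E u v u≢v du dv)) )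
  , λ not-tree → decidable-stable (dim H₁ ℤ.≤? dim H₂) λ ¬dim≤ → not-tree (connected₂ , λ cycle →
      let (p′ , q′ , p′q′ , q′⇝p′) = cycle-edge H₂ cycle in
      ≼⇒rainbow H₁≼H₂ λ E → ¬dim≤ (dim≤dim H₁ H₂ (Shape.arcs+2∣V∣≤arcs+2∣V∣ H₂ p′q′ t H₁ connected₁ E
        (deleteEdge-connected H₂ connected₂ q′⇝p′))))
  where
  connected₁ : Connected H₁
  connected₁ = In𝓗.connected H₁∈𝓗
  connected₂ : Connected H₂
  connected₂ = In𝓗.connected H₂∈𝓗
  2≤∣V∣ : 2 ≤ ∣V∣ H₂
  2≤∣V∣ = ≤-trans (ℕ.n≤1+n 2) (In𝓗⇒3≤∣V∣ H₂ H₂∈𝓗)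
  edge : ∃₂ λ p q → adj H₂ p q ≡ true
  edge = connected-edge H₂ connected₂ 2≤∣V∣
  p q : Fin (n H₂)
  p = proj₁ edge
  q = proj₁ (proj₂ edge)
  module S = Shape H₂ (proj₂ (proj₂ edge)) t H₁ connected₁
  via-copy : ∀ {A : Set} → Dec A → (Colouring.RainbowEmbedding H₂ p q t H₁ → A) → A
  via-copy dec f = decidable-stable dec (¬¬-map f (≼⇒rainbow H₁≼H₂))
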